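{- Let $\ell,n,\Delta\in\mathbb{N}^+$. Then every deterministic $(\ell,n,\Delta)$-Static Ranker requires at least $$\mathcal{B}=\left\lfloor \frac{n}{\lceil \Delta/\ell\rceil}\right\rfloor\cdot\log_2\!\Big(\max\big\{\lfloor \ell/\Delta\rfloor,1\big\}+1\Big)$$ bits of memory.
   Context: For a value $V$ and $\epsilon>0$, $\widehat V$ is an $\epsilon$-additive approximation of $V$ if $V-\epsilon<\widehat V\le V$. For $\ell,n,\Delta\in\mathbb{N}^+$, an $(\ell,n,\Delta)$-Static Ranker is a data structure that preprocesses a sequence $x=(x_1,\dots,x_n)\in\{0,1,\dots,\ell\}^n$ and, when queried with any $i\le n$, returns (in $O(1)$ time, word RAM with word size $\Theta(\log n+\log\ell)$) a $\Delta$-additive approximation of $S_i=\sum_{d=1}^i x_d$. Its memory is the number of bits of the structure stored after preprocessing (on which the answers to queries depend). -}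

module Defs where

open import Data.Nat using (ℕ; suc; _∸_; _/_; _⊔_; _^_; _≤_)
open import Data.Nat.DivMod
open import Data.Fin using (Fin; toℕ)
open import Data.Bool using (Bool)
open import Data.Vec using (Vec; toList)
open import Data.List using (take; map)
open import Data.Nat.ListAction using (sum)
open import Data.Integer using (ℤ; +_; _-_; _<_) renaming (_≤_ to _≤ℤ_)
open import Data.Product using (_×_)

Input : ℕ → ℕ → Set
Input ℓ n = Vec (Fin (suc ℓ)) n

S : ∀ {ℓ n} → Input ℓ n → ℕ → ℕ
S x i = sum (take i (map toℕ (toList x)))

IsAddApprox : ℕ → ℤ → ℕ → Set
IsAddApprox Δ Vh V = ((+ V) - (+ Δ) < Vh) × (Vh ≤ℤ + V)

-- Query index  i : Fin n  stands for  toℕ i + 1 ∈ {1,…,n}.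
record StaticRanker (ℓ n Δ m : ℕ) : Set where
  field
    preprocess : Input ℓ n → Vec Bool m
    query      : Vec Bool m → Fin n → ℤ
    correct    : ∀ (x : Input ℓ n) (i : Fin n) →
                 IsAddApprox Δ (query (preprocess x) i) (S x (suc (toℕ i)))

-- ⌈Δ/ℓ⌉ for Δ ≥ 1, ℓ ≥ 1 :  1 + ⌊(Δ-1)/ℓ⌋.
ceilDiv : (Δ ℓ : ℕ) → .{{_ : Data.Nat.NonZero ℓ}} → ℕ
ceilDiv Δ ℓ = suc ((Δ ∸ 1) / ℓ)

-- The bound B = ⌊n/⌈Δ/ℓ⌉⌋ · log₂(max{⌊ℓ/Δ⌋,1}+1) expressed exponentially:
-- m ≥ B  ⟺  2^m ≥ (max{⌊ℓ/Δ⌋,1}+1)^⌊n/⌈Δ/ℓ⌉⌋.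
boundPow : (ℓ n Δ : ℕ) → .{{_ : Data.Nat.NonZero ℓ}} → .{{_ : Data.Nat.NonZero Δ}} → ℕ
boundPow ℓ n Δ = (suc ((ℓ / Δ) ⊔ 1)) ^ (n / ceilDiv Δ ℓ)

-- Split the n positions into ⌊n/c⌋ blocks of c = ⌈Δ/ℓ⌉ positions and fill block j with
-- the constant value f(j)·w, where f(j) ∈ {0,…,q}, q = max{⌊ℓ/Δ⌋,1} and w is chosen
-- with q·w ≤ ℓ and Δ ≤ c·w.  At the end of each block the prefix sum is a multiple of
-- c·w ≥ Δ, so a Δ-additive approximation of it determines it exactly.  Hence the
-- stored memory determines every partial sum of f, hence f itself: the (q+1)^⌊n/c⌋
-- choices of f need pairwise different memories, so (q+1)^⌊n/c⌋ ≤ 2^m.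
module Submission where

open import Defs
open import Data.Nat
  using (ℕ; NonZero; zero; suc; _+_; _*_; _∸_; _^_; _/_; _%_; _⊔_; _≤_; _<_; z≤n; s≤s; s≤s⁻¹; _<?_; _≤?_)
open import Data.Nat.Properties
open import Data.Nat.DivMod
open import Data.Nat.Divisibility using (n∣m*n)
import Data.Fin as Fin
open import Data.Fin using (Fin; toℕ; fromℕ<; funToFin; finToFun; combine)
open import Data.Fin.Properties
  using (toℕ-fromℕ<; fromℕ<-toℕ; toℕ-injective; toℕ<n; injective⇒≤; 2↔Bool; finToFun-funToFin; funToFin-finToFin)
open import Data.Bool using (Bool)
open import Data.Vec using (Vec; []; _∷_; lookup; tabulate)
open import Data.Vec.Properties using (tabulate∘lookup; tabulate-cong)
import Data.Integer as ℤ
import Data.Integer.Properties as ℤₚ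
open import Data.Product using (Σ; _×_; _,_; proj₁; proj₂)
open import Function using (_∘_; Inverse)
open import Relation.Binary.PropositionalEquality
open import Relation.Nullary using (yes; no)
open import Data.Empty using (⊥-elim)

sumTo : (ℕ → ℕ) → ℕ → ℕ
sumTo h zero    = 0
sumTo h (suc k) = h 0 + sumTo (h ∘ suc) k

sumTo-+ : ∀ h a k → sumTo h (a + k) ≡ sumTo h a + sumTo (λ r → h (a + r)) k
sumTo-+ h zero    k = refl
sumTo-+ h (suc a) k = trans (cong (h 0 +_) (sumTo-+ (h ∘ suc) a k)) (sym (+-assoc (h 0) _ _))

sumTo-cong : ∀ {h g} k → (∀ r → r < k → h r ≡ g r) → sumTo h k ≡ sumTo g k
sumTo-cong zero    eq = refl
sumTo-cong (suc k) eq = cong₂ _+_ (eq 0 (s≤s z≤n)) (sumTo-cong k (λ r r<k → eq (suc r) (s≤s r<k)))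

sumTo-const : ∀ a k → sumTo (λ _ → a) k ≡ k * a
sumTo-const a zero    = refl
sumTo-const a (suc k) = cong (a +_) (sumTo-const a k)

sumTo-*ʳ : ∀ h w k → sumTo (λ j → h j * w) k ≡ sumTo h k * w
sumTo-*ʳ h w zero    = refl
sumTo-*ʳ h w (suc k) = trans (cong (h 0 * w +_) (sumTo-*ʳ (h ∘ suc) w k)) (sym (*-distribʳ-+ w (h 0) _))

sumTo-suc : ∀ h j → sumTo h (suc j) ≡ sumTo h j + h j
sumTo-suc h j = begin
  sumTo h (suc j)                  ≡⟨ cong (sumTo h) (+-comm 1 j) ⟩
  sumTo h (j + 1)                  ≡⟨ sumTo-+ h j 1 ⟩
  sumTo h j + (h (j + 0) + 0)      ≡⟨ cong (λ z → sumTo h j + z) (trans (+-identityʳ _) (cong h (+-identityʳ j))) ⟩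
  sumTo h j + h j                  ∎
  where open ≡-Reasoning

sumTo-prefixes⇒≡ : ∀ {h g} b → (∀ k → k ≤ b → sumTo h k ≡ sumTo g k) → ∀ j → j < b → h j ≡ g j
sumTo-prefixes⇒≡ {h} {g} b same j j<b = +-cancelˡ-≡ (sumTo h j) _ _ (begin
  sumTo h j + h j   ≡⟨ sym (sumTo-suc h j) ⟩
  sumTo h (suc j)   ≡⟨ same (suc j) j<b ⟩
  sumTo g (suc j)   ≡⟨ sumTo-suc g j ⟩
  sumTo g j + g j   ≡⟨ cong (_+ g j) (sym (same j (<⇒≤ j<b))) ⟩
  sumTo h j + g j   ∎)
  where open ≡-Reasoning

[j*c+r]/c≡j : ∀ j r c .{{_ : NonZero c}} → r < c → (j * c + r) / c ≡ j
[j*c+r]/c≡j j r c r<c = begin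
  (j * c + r) / c     ≡⟨ +-distrib-/-∣ˡ r (n∣m*n j) ⟩
  j * c / c + r / c   ≡⟨ cong₂ _+_ (m*n/n≡m j c) (m<n⇒m/n≡0 r<c) ⟩
  j + 0               ≡⟨ +-identityʳ j ⟩
  j                   ∎
  where open ≡-Reasoning

sumTo-stretch : ∀ h c .{{_ : NonZero c}} k → sumTo (λ p → h (p / c)) (k * c) ≡ c * sumTo h k
sumTo-stretch h c zero    = sym (*-zeroʳ c)
sumTo-stretch h c (suc k) = begin
  sumTo h′ (c + k * c)                                  ≡⟨ cong (sumTo h′) (+-comm c (k * c)) ⟩
  sumTo h′ (k * c + c)                                  ≡⟨ sumTo-+ h′ (k * c) c ⟩
  sumTo h′ (k * c) + sumTo (λ r → h′ (k * c + r)) c     ≡⟨ cong₂ _+_ (sumTo-stretch h c k) last-block ⟩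
  c * sumTo h k + sumTo (λ _ → h k) c                   ≡⟨ cong (c * sumTo h k +_) (sumTo-const (h k) c) ⟩
  c * sumTo h k + c * h k                               ≡⟨ sym (*-distribˡ-+ c (sumTo h k) (h k)) ⟩
  c * (sumTo h k + h k)                                 ≡⟨ cong (c *_) (sym (sumTo-suc h k)) ⟩
  c * sumTo h (suc k)                                   ∎
  where
  open ≡-Reasoning
  h′ : ℕ → ℕ
  h′ p = h (p / c)
  last-block : sumTo (λ r → h′ (k * c + r)) c ≡ sumTo (λ _ → h k) c
  last-block = sumTo-cong c (λ r r<c → cong h ([j*c+r]/c≡j k r c r<c))

buildInput : ∀ {ℓ} n (h : ℕ → ℕ) → (∀ p → h p ≤ ℓ) → Input ℓ n
buildInput zero    h h≤ℓ = []
buildInput (suc n) h h≤ℓ = fromℕ< (s≤s (h≤ℓ 0)) ∷ buildInput n (h ∘ suc) (h≤ℓ ∘ suc)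

S-buildInput : ∀ {ℓ} n h h≤ℓ k → k ≤ n → S (buildInput {ℓ} n h h≤ℓ) k ≡ sumTo h k
S-buildInput n       h h≤ℓ zero    _         = refl
S-buildInput (suc n) h h≤ℓ (suc k) (s≤s k≤n) =
  cong₂ _+_ (toℕ-fromℕ< _) (S-buildInput n (h ∘ suc) (h≤ℓ ∘ suc) k k≤n)

approx-close : ∀ Δ Q a b → IsAddApprox Δ Q a → IsAddApprox Δ Q b → a < b + Δ
approx-close Δ Q a b (a-Δ<Q , _) (_ , Q≤b) with Δ ≤? a
... | no Δ≰a  = <-≤-trans (≰⇒> Δ≰a) (m≤n+m Δ b)
... | yes Δ≤a = begin-strict
    a               ≡⟨ sym (m∸n+n≡m Δ≤a) ⟩
    (a ∸ Δ) + Δ     <⟨ +-monoˡ-< Δ a∸Δ<b ⟩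
    b + Δ           ∎
  where
  open ≤-Reasoning
  a-Δ≡a∸Δ : (ℤ.+ a) ℤ.- (ℤ.+ Δ) ≡ ℤ.+ (a ∸ Δ)
  a-Δ≡a∸Δ = trans (ℤₚ.[+m]-[+n]≡m⊖n a Δ) (ℤₚ.⊖-≥ Δ≤a)
  a∸Δ<b : a ∸ Δ < b
  a∸Δ<b = ℤₚ.drop‿+<+ (ℤₚ.<-≤-trans (subst (ℤ._< Q) a-Δ≡a∸Δ a-Δ<Q) Q≤b)

-- Multiples of a step d ≥ Δ are further than Δ apart, so one value approximates at most one.
approx-multiple-unique : ∀ {Δ Q} d A B → Δ ≤ d →
  IsAddApprox Δ Q (d * A) → IsAddApprox Δ Q (d * B) → A ≡ B
approx-multiple-unique {Δ} {Q} d A B Δ≤d QA QB = ≤-antisym (below A B QA QB) (below B A QB QA)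
  where
  below : ∀ A B → IsAddApprox Δ Q (d * A) → IsAddApprox Δ Q (d * B) → A ≤ B
  below A B QA QB = s≤s⁻¹ (*-cancelˡ-< d A (suc B) (begin-strict
    d * A         <⟨ approx-close Δ Q _ _ QA QB ⟩
    d * B + Δ     ≤⟨ +-monoʳ-≤ (d * B) Δ≤d ⟩
    d * B + d     ≡⟨ +-comm (d * B) d ⟩
    d + d * B     ≡⟨ sym (*-suc d B) ⟩
    d * suc B     ∎))
    where open ≤-Reasoning

module _ {ℓ n Δ m} (R : StaticRanker ℓ n Δ m) where
  open StaticRanker R

  same-memory⇒common-approx : ∀ {x y} → preprocess x ≡ preprocess y → ∀ t .{{_ : NonZero t}} → t ≤ n →
    Σ ℤ.ℤ λ Q → IsAddApprox Δ Q (S x t) × IsAddApprox Δ Q (S y t)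
  same-memory⇒common-approx {x} {y} same (suc t) t<n =
    query (preprocess x) i , at x , subst (λ M → IsAddApprox Δ (query M i) (S y (suc t))) (sym same) (at y)
    where
    i : Fin n
    i = fromℕ< t<n
    at : ∀ z → IsAddApprox Δ (query (preprocess z) i) (S z (suc t))
    at z = subst (IsAddApprox Δ (query (preprocess z) i) ∘ S z ∘ suc) (toℕ-fromℕ< t<n) (correct z i)

extend : ∀ {b k} → (Fin b → Fin k) → ℕ → ℕ
extend {b} f j with j <? b
... | yes j<b = toℕ (f (fromℕ< j<b))
... | no  _   = 0

extend≤ : ∀ {b q} (f : Fin b → Fin (suc q)) j → extend f j ≤ q
extend≤ {b} f j with j <? b
... | yes j<b = s≤s⁻¹ (toℕ<n (f (fromℕ< j<b)))
... | no  _   = z≤n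

extend-toℕ : ∀ {b k} (f : Fin b → Fin k) (j : Fin b) → extend f (toℕ j) ≡ toℕ (f j)
extend-toℕ {b} f j with toℕ j <? b
... | yes j<b = cong (toℕ ∘ f) (fromℕ<-toℕ j j<b)
... | no  j≮b = ⊥-elim (j≮b (toℕ<n j))

funToFin-cong : ∀ {b k} {f g : Fin b → Fin k} → f ≗ g → funToFin f ≡ funToFin g
funToFin-cong {zero}  f≗g = refl
funToFin-cong {suc b} f≗g = cong₂ combine (f≗g Fin.zero) (funToFin-cong (f≗g ∘ Fin.suc))

finToFun-injective : ∀ {b k} {a a′ : Fin (k ^ b)} → finToFun {k} {b} a ≗ finToFun a′ → a ≡ a′
finToFun-injective {b} {k} {a} {a′} same = begin
  a                                    ≡⟨ sym (funToFin-finToFin {b} {k} a) ⟩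
  funToFin (finToFun {k} {b} a)        ≡⟨ funToFin-cong same ⟩
  funToFin (finToFun {k} {b} a′)       ≡⟨ funToFin-finToFin {b} {k} a′ ⟩
  a′                     ∎
  where open ≡-Reasoning

bits⇒Fin : ∀ {m} → Vec Bool m → Fin (2 ^ m)
bits⇒Fin v = funToFin (Inverse.from 2↔Bool ∘ lookup v)

bits⇒Fin-injective : ∀ {m} {u v : Vec Bool m} → bits⇒Fin u ≡ bits⇒Fin v → u ≡ v
bits⇒Fin-injective {m} {u} {v} same = begin
  u                    ≡⟨ sym (tabulate∘lookup u) ⟩
  tabulate (lookup u)  ≡⟨ tabulate-cong lookups ⟩
  tabulate (lookup v)  ≡⟨ tabulate∘lookup v ⟩
  v                    ∎
  where
  open ≡-Reasoning
  open Inverse 2↔Bool using (to; from; strictlyInverseˡ)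
  lookups : lookup u ≗ lookup v
  lookups i = begin
    lookup u i                     ≡⟨ sym (strictlyInverseˡ _) ⟩
    to (from (lookup u i))         ≡⟨ cong to (sym (finToFun-funToFin (from ∘ lookup u) i)) ⟩
    to (finToFun (bits⇒Fin u) i)   ≡⟨ cong (λ a → to (finToFun a i)) same ⟩
    to (finToFun (bits⇒Fin v) i)   ≡⟨ cong to (finToFun-funToFin (from ∘ lookup v) i) ⟩
    to (from (lookup v i))         ≡⟨ strictlyInverseˡ _ ⟩
    lookup v i                     ∎

injective-into-bits⇒≤ : ∀ {k m} (enc : Fin k → Vec Bool m) → (∀ {a a′} → enc a ≡ enc a′ → a ≡ a′) → k ≤ 2 ^ m
injective-into-bits⇒≤ enc enc-injective = injective⇒≤ (enc-injective ∘ bits⇒Fin-injective {u = enc _} {v = enc _})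

module BlockInputs {ℓ n Δ m} (R : StaticRanker ℓ n Δ m) (c w q b : ℕ) .{{_ : NonZero c}}
                   (Δ≤c*w : Δ ≤ c * w) (q*w≤ℓ : q * w ≤ ℓ) (b*c≤n : b * c ≤ n) where
  open StaticRanker R

  height : (Fin b → Fin (suc q)) → ℕ → ℕ
  height f p = extend f (p / c) * w

  height≤ℓ : ∀ f p → height f p ≤ ℓ
  height≤ℓ f p = ≤-trans (*-monoˡ-≤ w (extend≤ f (p / c))) q*w≤ℓ

  input : (Fin b → Fin (suc q)) → Input ℓ n
  input f = buildInput n (height f) (height≤ℓ f)

  S-input-block : ∀ f k → k * c ≤ n → S (input f) (k * c) ≡ (c * w) * sumTo (extend f) k
  S-input-block f k k*c≤n = begin
    S (input f) (k * c)                            ≡⟨ S-buildInput n (height f) (height≤ℓ f) (k * c) k*c≤n ⟩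
    sumTo (height f) (k * c)                       ≡⟨ sumTo-stretch (λ j → extend f j * w) c k ⟩
    c * sumTo (λ j → extend f j * w) k             ≡⟨ cong (c *_) (sumTo-*ʳ (extend f) w k) ⟩
    c * (sumTo (extend f) k * w)                   ≡⟨ cong (c *_) (*-comm (sumTo (extend f) k) w) ⟩
    c * (w * sumTo (extend f) k)                   ≡⟨ sym (*-assoc c w (sumTo (extend f) k)) ⟩
    (c * w) * sumTo (extend f) k                   ∎
    where open ≡-Reasoning

  same-memory⇒same-block-sums : ∀ {f g} → preprocess (input f) ≡ preprocess (input g) →
    ∀ k → k ≤ b → sumTo (extend f) k ≡ sumTo (extend g) k
  same-memory⇒same-block-sums same zero    _   = refl
  same-memory⇒same-block-sums {f} {g} same k@(suc _) k≤b =
    approx-multiple-unique (c * w) _ _ Δ≤c*w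
      (subst (IsAddApprox Δ Q) (S-input-block f k k*c≤n) Qf)
      (subst (IsAddApprox Δ Q) (S-input-block g k k*c≤n) Qg)
    where
    k*c≤n : k * c ≤ n
    k*c≤n = ≤-trans (*-monoˡ-≤ c k≤b) b*c≤n
    common = same-memory⇒common-approx R same (k * c) {{m*n≢0 k c}} k*c≤n
    Q = proj₁ common
    Qf = proj₁ (proj₂ common)
    Qg = proj₂ (proj₂ common)

  memory-injective : ∀ {f g} → preprocess (input f) ≡ preprocess (input g) → f ≗ g
  memory-injective {f} {g} same j = toℕ-injective (begin
    toℕ (f j)          ≡⟨ sym (extend-toℕ f j) ⟩
    extend f (toℕ j)   ≡⟨ sumTo-prefixes⇒≡ b (same-memory⇒same-block-sums same) (toℕ j) (toℕ<n j) ⟩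
    extend g (toℕ j)   ≡⟨ extend-toℕ g j ⟩
    toℕ (g j)          ∎)
    where open ≡-Reasoning

  block-bound : suc q ^ b ≤ 2 ^ m
  block-bound = injective-into-bits⇒≤ (preprocess ∘ input ∘ finToFun)
    (finToFun-injective ∘ memory-injective)

m≤⌈m/n⌉*n : ∀ m n .{{_ : NonZero m}} .{{_ : NonZero n}} → m ≤ ceilDiv m n * n
m≤⌈m/n⌉*n (suc m) n = begin-strict
  m                    ≡⟨ m≡m%n+[m/n]*n m n ⟩
  m % n + (m / n) * n  <⟨ +-monoˡ-< ((m / n) * n) (m%n<n m n) ⟩
  n + (m / n) * n      ∎
  where open ≤-Reasoning

block-width : ∀ ℓ Δ .{{_ : NonZero ℓ}} .{{_ : NonZero Δ}} →
  Σ ℕ λ w → Δ ≤ ceilDiv Δ ℓ * w × ((ℓ / Δ) ⊔ 1) * w ≤ ℓ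
block-width ℓ Δ with Δ ≤? ℓ
... | yes Δ≤ℓ = Δ , m≤n*m Δ (ceilDiv Δ ℓ) , q*Δ≤ℓ
  where
  q*Δ≤ℓ : ((ℓ / Δ) ⊔ 1) * Δ ≤ ℓ
  q*Δ≤ℓ rewrite m≥n⇒m⊔n≡m (m≥n⇒m/n>0 {ℓ} {Δ} Δ≤ℓ) = m/n*n≤m ℓ Δ
... | no  Δ≰ℓ = ℓ , m≤⌈m/n⌉*n Δ ℓ , q*ℓ≤ℓ
  where
  q*ℓ≤ℓ : ((ℓ / Δ) ⊔ 1) * ℓ ≤ ℓ
  q*ℓ≤ℓ rewrite m<n⇒m/n≡0 {ℓ} {Δ} (≰⇒> Δ≰ℓ) = ≤-reflexive (+-identityʳ ℓ)

theorem2 : (ℓ n Δ : ℕ) → .{{_ : NonZero ℓ}} → .{{_ : NonZero n}} → .{{_ : NonZero Δ}} →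
    (m : ℕ) → StaticRanker ℓ n Δ m → boundPow ℓ n Δ ≤ 2 ^ m
theorem2 ℓ n Δ m R with block-width ℓ Δ
... | w , Δ≤c*w , q*w≤ℓ =
  BlockInputs.block-bound R (ceilDiv Δ ℓ) w ((ℓ / Δ) ⊔ 1) (n / ceilDiv Δ ℓ)
    Δ≤c*w q*w≤ℓ (m/n*n≤m n (ceilDiv Δ ℓ))
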